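{- Let $G$ be the incidence graph of a $\mathrm{BIBD}(v,b,r,k,\lambda)$ with point set $X$ and block collection $\mathcal{B}$, where $2 \le \lambda \le r-1$. Then $\zeta(G) \le f(G) + r + 1$, where $f(G)$ is defined as follows: for $u \in X$, let $X_1,\dots,X_\alpha$ be the partition of $X\setminus\{u\}$ into maximal nonempty sets such that $\{u\} \cup X_i$ is contained in exactly $\lambda$ blocks (equivalently, $x,y \in X\setminus\{u\}$ lie in the same part iff every block containing $\{u,x\}$ also contains $y$); set $f(u) = \sum_{i=1}^{\alpha} (|X_i| - 1)$ and $f(G) = \min_{u \in X} f(u)$.
   Context: A $\mathrm{BIBD}(v,b,r,k,\lambda)$ (balanced incomplete block design) is a set $X$ of $v$ points together with a collection $\mathcal{B}$ of $b$ blocks (subsets of $X$, possibly repeated) such that every block has size $k$, every point lies in exactly $r$ blocks, and every pair of distinct points lies in exactly $\lambda$ blocks. Its incidence graph is the bipartite graph on $X \cup \mathcal{B}$ (each block a separate vertex) with $x \sim B$ iff $x \in B$. Localization game on a connected graph $G$ with $k$ cops: the robber chooses a starting vertex, invisible to the cops. Each round the cops choose any $k$ vertices (no adjacency restriction) and each learns its distance to the robber; the cops win if after finitely many rounds they determine the robber's vertex uniquely; otherwise the robber moves to a neighbour or stays. The robber knows the cops' strategy. $\zeta(G)$ is the least $k$ for which $k$ cops can guarantee capture. -}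

module Defs where

open import Data.Bool using (Bool; true; false; _∧_; _∨_; not; if_then_else_)
open import Data.Nat using (ℕ; zero; suc; _+_; _∸_; _⊓_; _<ᵇ_; _≤_)
open import Data.Fin using (Fin; zero; suc; toℕ)
import Data.Fin as Fin
open import Data.Fin.Properties using () renaming (_≟_ to _≟F_)
open import Data.Sum using (_⊎_; inj₁; inj₂)
open import Data.Sum.Properties using (≡-dec)
open import Data.Product using (Σ; ∃; _×_; _,_)
open import Data.List using (List; []; _∷_; _++_; map; length)
open import Data.Bool.ListAction using (any)
open import Data.List.Membership.Propositional using (_∈_)
open import Data.List.Membership.Propositional.Properties using (∈-++⁺ˡ; ∈-++⁺ʳ; ∈-map⁺; ∈-allFin)
open import Data.Vec using (Vec)
import Data.Vec as Vec
open import Data.List using (allFin)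
open import Relation.Binary.PropositionalEquality using (_≡_; _≢_)
open import Relation.Binary.Definitions using (DecidableEquality)
open import Relation.Nullary.Decidable using (⌊_⌋)

sumFin : ∀ {n} → (Fin n → ℕ) → ℕ
sumFin {zero}  f = 0
sumFin {suc n} f = f zero + sumFin (λ i → f (suc i))

countFin : ∀ {n} → (Fin n → Bool) → ℕ
countFin p = sumFin (λ i → if p i then 1 else 0)

allFinB : ∀ {n} → (Fin n → Bool) → Bool
allFinB {zero}  p = true
allFinB {suc n} p = p zero ∧ allFinB (λ i → p (suc i))

anyFinB : ∀ {n} → (Fin n → Bool) → Bool
anyFinB {zero}  p = false
anyFinB {suc n} p = p zero ∨ anyFinB (λ i → p (suc i))

-- minimum of f over Fin n (the value for n = 0 is an irrelevant default)
minFin : ∀ {n} → (Fin n → ℕ) → ℕ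
minFin {zero}        f = 0
minFin {suc zero}    f = f zero
minFin {suc (suc n)} f = f zero ⊓ minFin {suc n} (λ i → f (suc i))

_==F_ : ∀ {n} → Fin n → Fin n → Bool
x ==F y = ⌊ x ≟F y ⌋

-- BIBD(v,b,r,k,λ): points Fin v, blocks Fin b (so repeated blocks are
-- allowed: distinct indices may have the same point set), incidence inc.

record BIBD (v b r k lam : ℕ) : Set where
  field
    inc        : Fin v → Fin b → Bool
    blockSize  : ∀ (B : Fin b) → countFin (λ x → inc x B) ≡ k
    replication : ∀ (x : Fin v) → countFin (λ B → inc x B) ≡ r
    balance    : ∀ (x y : Fin v) → x ≢ y →
                 countFin (λ B → inc x B ∧ inc y B) ≡ lam

record Graph : Set₁ where
  field
    V        : Set
    _≟V_     : DecidableEquality V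
    verts    : List V
    complete : ∀ (x : V) → x ∈ verts
    adj      : V → V → Bool

module _ (G : Graph) where
  open Graph G

  reach : ℕ → V → V → Bool
  reach zero    x y = ⌊ x ≟V y ⌋
  reach (suc d) x y = reach d x y ∨ any (λ z → reach d x z ∧ adj z y) verts

  -- least i < n with p i = true, or n if there is none
  firstTrue : (ℕ → Bool) → ℕ → ℕ
  firstTrue p zero    = 0
  firstTrue p (suc n) = if p 0 then 0 else suc (firstTrue (λ i → p (suc i)) n)

  -- shortest-path distance (for a connected graph, always < |V|)
  dist : V → V → ℕ
  dist x y = firstTrue (λ d → reach d x y) (length verts)

module _ (G : Graph) where
  open Graph G

  -- a cop strategy: given all previous answers (most recent first),
  -- choose the m probed vertices of the next round
  Strategy : ℕ → Set
  Strategy m = List (Vec ℕ m) → Vec V m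

  -- robber trajectory: w i is the robber's vertex during round i;
  -- between rounds it stays or moves to a neighbour
  IsWalk : (ℕ → V) → Set
  IsWalk w = ∀ i → (w (suc i) ≡ w i) ⊎ (adj (w i) (w (suc i)) ≡ true)

  -- answers received in rounds 0 .. i-1 (most recent first)
  history : ∀ {m} → Strategy m → (ℕ → V) → ℕ → List (Vec ℕ m)
  history S w zero    = []
  history S w (suc i) =
    Vec.map (λ c → dist G c (w i)) (S (history S w i)) ∷ history S w i

  -- after round t the cops know the robber's vertex uniquely: every robber
  -- walk producing the same answers in rounds 0..t is at the same vertex
  CapturedAt : ∀ {m} → Strategy m → (ℕ → V) → ℕ → Set
  CapturedAt S w t = ∀ (w' : ℕ → V) → IsWalk w' →
    history S w' (suc t) ≡ history S w (suc t) → w' t ≡ w t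

  CopsWin : ℕ → Set
  CopsWin m = Σ (Strategy m) λ S → ∀ (w : ℕ → V) → IsWalk w → ∃ λ t → CapturedAt S w t

  ZetaAtMost : ℕ → Set
  ZetaAtMost N = ∃ λ m → m ≤ N × CopsWin m

module _ {v b r k lam : ℕ} (D : BIBD v b r k lam) where
  open BIBD D

  incAdj : Fin v ⊎ Fin b → Fin v ⊎ Fin b → Bool
  incAdj (inj₁ x) (inj₂ B) = inc x B
  incAdj (inj₂ B) (inj₁ x) = inc x B
  incAdj (inj₁ _) (inj₁ _) = false
  incAdj (inj₂ _) (inj₂ _) = false

  incVerts : List (Fin v ⊎ Fin b)
  incVerts = map inj₁ (allFin v) ++ map inj₂ (allFin b)

  incComplete : ∀ z → z ∈ incVerts
  incComplete (inj₁ x) = ∈-++⁺ˡ (∈-map⁺ inj₁ (∈-allFin x))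
  incComplete (inj₂ B) = ∈-++⁺ʳ (map inj₁ (allFin v)) (∈-map⁺ inj₂ (∈-allFin B))

  IncidenceGraph : Graph
  IncidenceGraph = record
    { V = Fin v ⊎ Fin b
    ; _≟V_ = ≡-dec _≟F_ _≟F_
    ; verts = incVerts
    ; complete = incComplete
    ; adj = incAdj
    }

  -- Each part X_i of the partition is indexed by its least
  -- element (in the order of Fin v); f(u) = Σ_i (|X_i| - 1).

  sameClass : Fin v → Fin v → Fin v → Bool
  sameClass u x y = allFinB (λ B → not (inc u B ∧ inc x B) ∨ inc y B)

  inClassOf : Fin v → Fin v → Fin v → Bool
  inClassOf u x y = not (y ==F u) ∧ sameClass u x y

  classSize : Fin v → Fin v → ℕ
  classSize u x = countFin (inClassOf u x)

  isRep : Fin v → Fin v → Bool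
  isRep u x = not (x ==F u) ∧ not (anyFinB (λ y → (toℕ y <ᵇ toℕ x) ∧ inClassOf u x y))

  f : Fin v → ℕ
  f u = sumFin (λ x → if isRep u x then classSize u x ∸ 1 else 0)

  fG : ℕ
  fG = minFin f

-- Fix a point u minimising f. In every round the cops probe the r blocks through u, the points of
-- X ∖ {u} that are not the least element of their part (at most f(u) of them), and one spare vertex
-- that sweeps through the blocks. A robber on a point x is located at once: its distances to the
-- blocks through u reveal which of them contain x, hence the part of x; a probed point is seen at
-- distance 0, and the least element of a part is determined by its part, while u is told apart
-- because no other point lies in all r blocks through u (λ < r). Blocks are pairwise non-adjacent,
-- so a robber who never reaches a point sits on its first block until the spare probe hits it.

module Submission where

open import Defs
open import Data.Bool using (Bool; true; false; _∧_; _∨_; not; if_then_else_)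
open import Data.Bool.ListAction using (any)
open import Data.Bool.Properties using (∧-zeroʳ; ∨-zeroʳ; T-≡)
open import Data.Empty using (⊥-elim)
open import Data.Fin using (Fin; zero; suc; toℕ; fromℕ<)
import Data.Fin as Fin
open import Data.Fin.Induction using (<-wellFounded)
open import Data.Fin.Properties using (toℕ-injective; toℕ<n; fromℕ<-toℕ) renaming (_≟_ to _≟F_)
open import Data.List using (List; []; _∷_; _++_; map; length; allFin)
open import Data.List.Membership.Propositional using (_∈_)
open import Data.List.Membership.Propositional.Properties using (∈-++⁺ˡ; ∈-++⁺ʳ; ∈-map⁺)
open import Data.List.Properties using (length-map; length-++; length-tabulate; ∷-injectiveˡ)
open import Data.List.Relation.Unary.Any using (here; there)
open import Data.Nat using (ℕ; zero; suc; _+_; _∸_; _≤_; _<_; _<ᵇ_; _<?_; z≤n; s≤s)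
open import Data.Nat.Properties
open import Algebra.Properties.CommutativeSemigroup +-commutativeSemigroup using (interchange)
open import Data.Product using (Σ; ∃; _×_; _,_; proj₁; proj₂)
open import Data.Sum using (_⊎_; inj₁; inj₂)
import Data.Sum as Sum
open import Data.Vec using (Vec; []; _∷_; lookup)
import Data.Vec as Vec
open import Data.Vec.Properties using (lookup-map)
open import Function using (_∘_)
open import Function.Bundles using (Equivalence)
open import Induction.WellFounded using (Acc; acc)
open import Relation.Binary.Definitions using (tri<; tri≈; tri>)
open import Relation.Binary.PropositionalEquality
open import Relation.Nullary using (Dec; yes; no; ¬_)
open import Relation.Nullary.Decidable using (⌊_⌋; isYes≗does; dec-true; dec-false)

true≢false : true ≢ false
true≢false ()

∧-true⁻ : ∀ {a c} → a ∧ c ≡ true → a ≡ true × c ≡ true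
∧-true⁻ {true} c≡true = refl , c≡true

∧-true⁺ : ∀ {a c} → a ≡ true → c ≡ true → a ∧ c ≡ true
∧-true⁺ refl c≡true = c≡true

∧-false⁻ : ∀ {a c} → a ∧ c ≡ false → a ≡ false ⊎ c ≡ false
∧-false⁻ {false} _ = inj₁ refl
∧-false⁻ {true} c≡false = inj₂ c≡false

∨-true⁻ : ∀ {a c} → a ∨ c ≡ true → a ≡ true ⊎ c ≡ true
∨-true⁻ {true} _ = inj₁ refl
∨-true⁻ {false} c≡true = inj₂ c≡true

not-true⁻ : ∀ {a} → not a ≡ true → a ≡ false
not-true⁻ {false} _ = refl

not-false⁻ : ∀ {a} → not a ≡ false → a ≡ true
not-false⁻ {true} _ = refl

implication-true⁻ : ∀ {a c} → not a ∨ c ≡ true → a ≡ true → c ≡ true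
implication-true⁻ c≡true refl = c≡true

implication-true⁺ : ∀ {a c} → (a ≡ true → c ≡ true) → not a ∨ c ≡ true
implication-true⁺ {true} a⇒c = a⇒c refl
implication-true⁺ {false} _ = refl

<ᵇ-true⁻ : ∀ {m n} → (m <ᵇ n) ≡ true → m < n
<ᵇ-true⁻ {m} {n} e = <ᵇ⇒< m n (Equivalence.from T-≡ e)

<ᵇ-true⁺ : ∀ {m n} → m < n → (m <ᵇ n) ≡ true
<ᵇ-true⁺ m<n = Equivalence.to T-≡ (<⇒<ᵇ m<n)

⌊⌋-true⁻ : ∀ {A : Set} (d : Dec A) → ⌊ d ⌋ ≡ true → A
⌊⌋-true⁻ (yes a) _ = a

⌊⌋-true⁺ : ∀ {A : Set} (d : Dec A) → A → ⌊ d ⌋ ≡ true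
⌊⌋-true⁺ d a = trans (isYes≗does d) (dec-true d a)

⌊⌋-false⁻ : ∀ {A : Set} (d : Dec A) → ⌊ d ⌋ ≡ false → ¬ A
⌊⌋-false⁻ d e a = true≢false (trans (sym (⌊⌋-true⁺ d a)) e)

⌊⌋-false⁺ : ∀ {A : Set} (d : Dec A) → ¬ A → ⌊ d ⌋ ≡ false
⌊⌋-false⁺ d ¬a = trans (isYes≗does d) (dec-false d ¬a)

<⇒≤∸1 : ∀ {m n} → m < n → m ≤ n ∸ 1
<⇒≤∸1 (s≤s m≤n) = m≤n

≤∸1⇒< : ∀ {m n} → 1 ≤ m → m ≤ n ∸ 1 → m < n
≤∸1⇒< {n = zero} (s≤s _) ()
≤∸1⇒< {n = suc n} _ m≤n = s≤s m≤n

⟦_⟧ : Bool → ℕ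
⟦ a ⟧ = if a then 1 else 0

⟦⟧-mono : ∀ {a c} → (a ≡ true → c ≡ true) → ⟦ a ⟧ ≤ ⟦ c ⟧
⟦⟧-mono {false} _ = z≤n
⟦⟧-mono {true} a⇒c rewrite a⇒c refl = ≤-refl

sumFin-mono : ∀ {n} {f g : Fin n → ℕ} → (∀ i → f i ≤ g i) → sumFin f ≤ sumFin g
sumFin-mono {zero} _ = z≤n
sumFin-mono {suc n} f≤g = +-mono-≤ (f≤g zero) (sumFin-mono (f≤g ∘ suc))

sumFin-zero : ∀ {n} {f : Fin n → ℕ} → (∀ i → f i ≡ 0) → sumFin f ≡ 0
sumFin-zero {zero} _ = refl
sumFin-zero {suc n} f≡0 rewrite f≡0 zero = sumFin-zero (f≡0 ∘ suc)

sumFin-+ : ∀ {n} (f g : Fin n → ℕ) → sumFin (λ i → f i + g i) ≡ sumFin f + sumFin g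
sumFin-+ {zero} _ _ = refl
sumFin-+ {suc n} f g rewrite sumFin-+ (f ∘ suc) (g ∘ suc) =
  interchange (f zero) (g zero) (sumFin (f ∘ suc)) (sumFin (g ∘ suc))

sumFin-swap : ∀ {n m} (h : Fin n → Fin m → ℕ) →
  sumFin (λ i → sumFin (h i)) ≡ sumFin (λ j → sumFin (λ i → h i j))
sumFin-swap {zero} {m} _ = sym (sumFin-zero {m} (λ _ → refl))
sumFin-swap {suc n} h = begin
  sumFin (h zero) + sumFin (λ i → sumFin (h (suc i)))
    ≡⟨ cong (sumFin (h zero) +_) (sumFin-swap (h ∘ suc)) ⟩
  sumFin (h zero) + sumFin (λ j → sumFin (λ i → h (suc i) j))
    ≡⟨ sym (sumFin-+ (h zero) (λ j → sumFin (λ i → h (suc i) j))) ⟩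
  sumFin (λ j → sumFin (λ i → h i j)) ∎
  where open ≡-Reasoning

sumFin-term : ∀ {n} (f : Fin n → ℕ) (j : Fin n) → f j ≤ sumFin f
sumFin-term f zero = m≤m+n (f zero) _
sumFin-term f (suc j) = m≤n⇒m≤o+n (f zero) (sumFin-term (f ∘ suc) j)

count-witness : ∀ {n} (p : Fin n → Bool) → 1 ≤ countFin p → Σ (Fin n) λ i → p i ≡ true
count-witness {suc n} p pos with p zero in p0
... | true = zero , p0
... | false = let (i , pi) = count-witness (p ∘ suc) pos in suc i , pi

count-mono : ∀ {n} (p q : Fin n → Bool) → (∀ i → p i ≡ true → q i ≡ true) → countFin p ≤ countFin q
count-mono p q p⊆q = sumFin-mono (λ i → ⟦⟧-mono (p⊆q i))

count-< : ∀ {n} (p q : Fin n → Bool) → (∀ i → p i ≡ true → q i ≡ true) →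
  ∀ j → q j ≡ true → p j ≡ false → countFin p < countFin q
count-< p q p⊆q zero qj pj rewrite qj | pj = s≤s (count-mono (p ∘ suc) (q ∘ suc) (p⊆q ∘ suc))
count-< p q p⊆q (suc j) qj pj = begin-strict
  ⟦ p zero ⟧ + countFin (p ∘ suc)  <⟨ +-monoʳ-< ⟦ p zero ⟧ (count-< (p ∘ suc) (q ∘ suc) (p⊆q ∘ suc) j qj pj) ⟩
  ⟦ p zero ⟧ + countFin (q ∘ suc)  ≤⟨ +-monoˡ-≤ _ (⟦⟧-mono (p⊆q zero)) ⟩
  ⟦ q zero ⟧ + countFin (q ∘ suc)  ∎
  where open ≤-Reasoning

count-≡⇒⊇ : ∀ {n} (p q : Fin n → Bool) → (∀ i → p i ≡ true → q i ≡ true) →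
  countFin p ≡ countFin q → ∀ i → q i ≡ true → p i ≡ true
count-≡⇒⊇ p q p⊆q same i qi with p i in pi
... | true = refl
... | false = ⊥-elim (<-irrefl same (count-< p q p⊆q i qi pi))

count≤sum-count : ∀ {n m} (p : Fin n → Bool) (q : Fin m → Fin n → Bool) →
  (∀ i → p i ≡ true → Σ (Fin m) λ j → q j i ≡ true) →
  countFin p ≤ sumFin (λ j → countFin (q j))
count≤sum-count p q covered = begin
  countFin p                                 ≤⟨ sumFin-mono pointwise ⟩
  sumFin (λ i → sumFin (λ j → ⟦ q j i ⟧))    ≡⟨ sumFin-swap (λ i j → ⟦ q j i ⟧) ⟩
  sumFin (λ j → countFin (q j))              ∎
  where
  open ≤-Reasoning
  pointwise : ∀ i → ⟦ p i ⟧ ≤ sumFin (λ j → ⟦ q j i ⟧)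
  pointwise i with p i in pi
  ... | false = z≤n
  ... | true = let (j , qji) = covered i pi in
               ≤-trans (≤-reflexive (cong ⟦_⟧ (sym qji))) (sumFin-term (λ j → ⟦ q j i ⟧) j)

allFinB-true⁻ : ∀ {n} (p : Fin n → Bool) → allFinB p ≡ true → ∀ i → p i ≡ true
allFinB-true⁻ p all zero = proj₁ (∧-true⁻ all)
allFinB-true⁻ p all (suc i) = allFinB-true⁻ (p ∘ suc) (proj₂ (∧-true⁻ {p zero} all)) i

allFinB-true⁺ : ∀ {n} (p : Fin n → Bool) → (∀ i → p i ≡ true) → allFinB p ≡ true
allFinB-true⁺ {zero} _ _ = refl
allFinB-true⁺ {suc n} p all = ∧-true⁺ (all zero) (allFinB-true⁺ (p ∘ suc) (all ∘ suc))

anyFinB-true⁻ : ∀ {n} (p : Fin n → Bool) → anyFinB p ≡ true → Σ (Fin n) λ i → p i ≡ true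
anyFinB-true⁻ {suc n} p some with ∨-true⁻ {p zero} some
... | inj₁ p0 = zero , p0
... | inj₂ rest = let (i , pi) = anyFinB-true⁻ (p ∘ suc) rest in suc i , pi

anyFinB-true⁺ : ∀ {n} (p : Fin n → Bool) (i : Fin n) → p i ≡ true → anyFinB p ≡ true
anyFinB-true⁺ p zero pi rewrite pi = refl
anyFinB-true⁺ p (suc i) pi = trans (cong (p zero ∨_) (anyFinB-true⁺ (p ∘ suc) i pi)) (∨-zeroʳ (p zero))

minFin-attained : ∀ {n} (g : Fin (suc n) → ℕ) → Σ (Fin (suc n)) λ i → minFin g ≡ g i
minFin-attained {zero} g = zero , refl
minFin-attained {suc n} g with ⊓-sel (g zero) (minFin (g ∘ suc))
... | inj₁ min≡g0 = zero , min≡g0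
... | inj₂ min≡rest = let (i , rest≡gi) = minFin-attained (g ∘ suc) in suc i , trans min≡rest rest≡gi

filterFin : ∀ {n} → (Fin n → Bool) → List (Fin n)
filterFin {zero} _ = []
filterFin {suc n} p with p zero
... | true = zero ∷ map suc (filterFin (p ∘ suc))
... | false = map suc (filterFin (p ∘ suc))

length-filterFin : ∀ {n} (p : Fin n → Bool) → length (filterFin p) ≡ countFin p
length-filterFin {zero} _ = refl
length-filterFin {suc n} p with p zero
... | true = cong suc (trans (length-map suc (filterFin (p ∘ suc))) (length-filterFin (p ∘ suc)))
... | false = trans (length-map suc (filterFin (p ∘ suc))) (length-filterFin (p ∘ suc))

∈-filterFin⁺ : ∀ {n} (p : Fin n → Bool) {i} → p i ≡ true → i ∈ filterFin p
∈-filterFin⁺ p {zero} pi rewrite pi = here refl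
∈-filterFin⁺ p {suc i} pi with p zero
... | true = there (∈-map⁺ suc (∈-filterFin⁺ (p ∘ suc) pi))
... | false = ∈-map⁺ suc (∈-filterFin⁺ (p ∘ suc) pi)

module Probing (G : Graph) where
  open Graph G

  SameDistances : List V → V → V → Set
  SameDistances cs z z′ = ∀ c → c ∈ cs → dist G c z ≡ dist G c z′

  same-distances-sym : ∀ {cs z z′} → SameDistances cs z z′ → SameDistances cs z′ z
  same-distances-sym same c c∈cs = sym (same c c∈cs)

  Resolves : List V → V → Set
  Resolves cs z = ∀ z′ → SameDistances cs z z′ → z′ ≡ z

  pad : V → List V → (m : ℕ) → Vec V m
  pad d [] m = Vec.replicate m d
  pad d (c ∷ cs) zero = []
  pad d (c ∷ cs) (suc m) = c ∷ pad d cs m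

  pad-∈ : ∀ d {c} cs m → c ∈ cs → length cs ≤ m → Σ (Fin m) λ j → lookup (pad d cs m) j ≡ c
  pad-∈ d (c ∷ cs) (suc m) (here refl) _ = zero , refl
  pad-∈ d (c ∷ cs) (suc m) (there c∈cs) (s≤s len≤m) =
    let (j , at-j) = pad-∈ d cs m c∈cs len≤m in suc j , at-j

  -- The number of answers received so far is the round number, so round t probes L t.
  probing : ∀ {m} → V → (ℕ → List V) → Strategy G m
  probing {m} d L answers = pad d (L (length answers)) m

  length-history : ∀ {m} (S : Strategy G m) w t → length (history G S w t) ≡ t
  length-history S w zero = refl
  length-history S w (suc t) = cong suc (length-history S w t)

  probing-captures : ∀ {m} d L (w : ℕ → V) t → length (L t) ≤ m → Resolves (L t) (w t) →
    CapturedAt G (probing {m} d L) w t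
  probing-captures {m} d L w t len≤m resolves w′ _ same-answers = resolves (w′ t) same
    where
    S = probing {m} d L
    probed : ∀ w → S (history G S w t) ≡ pad d (L t) m
    probed w = cong (λ n → pad d (L n) m) (length-history S w t)
    same : SameDistances (L t) (w t) (w′ t)
    same c c∈L = begin
      dist G c (w t)                                        ≡⟨ cong (λ y → dist G y (w t)) (sym at-j) ⟩
      dist G (lookup (pad d (L t) m) j) (w t)               ≡⟨ sym (lookup-map j _ (pad d (L t) m)) ⟩
      lookup (Vec.map (λ y → dist G y (w t)) (pad d (L t) m)) j
        ≡⟨ cong (λ ps → lookup (Vec.map (λ y → dist G y (w t)) ps) j) (sym (probed w)) ⟩
      lookup (Vec.map (λ y → dist G y (w t)) (S (history G S w t))) j
        ≡⟨ cong (λ as → lookup as j) (sym (∷-injectiveˡ same-answers)) ⟩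
      lookup (Vec.map (λ y → dist G y (w′ t)) (S (history G S w′ t))) j
        ≡⟨ cong (λ ps → lookup (Vec.map (λ y → dist G y (w′ t)) ps) j) (probed w′) ⟩
      lookup (Vec.map (λ y → dist G y (w′ t)) (pad d (L t) m)) j
        ≡⟨ lookup-map j _ (pad d (L t) m) ⟩
      dist G (lookup (pad d (L t) m) j) (w′ t)              ≡⟨ cong (λ y → dist G y (w′ t)) at-j ⟩
      dist G c (w′ t)                                       ∎
      where
      open ≡-Reasoning
      j = proj₁ (pad-∈ d (L t) m c∈L len≤m)
      at-j = proj₂ (pad-∈ d (L t) m c∈L len≤m)

module Distance (G : Graph) (two-vertices : 2 ≤ length (Graph.verts G)) where
  open Graph G
  open Probing G

  private
    if-zero⁻ : ∀ a {m} → (if a then 0 else suc m) ≡ 0 → a ≡ true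
    if-zero⁻ true _ = refl

    if-one⁻ : ∀ a c {m} → (if a then 0 else suc (if c then 0 else suc m)) ≡ 1 → a ≡ false × c ≡ true
    if-one⁻ false true _ = refl , refl

    firstTrue≡0⁻ : ∀ p {n} → 2 ≤ n → firstTrue G p n ≡ 0 → p 0 ≡ true
    firstTrue≡0⁻ p (s≤s _) = if-zero⁻ (p 0)

    firstTrue≡0⁺ : ∀ p {n} → 2 ≤ n → p 0 ≡ true → firstTrue G p n ≡ 0
    firstTrue≡0⁺ p (s≤s _) p0 rewrite p0 = refl

    firstTrue≡1⁻ : ∀ p {n} → 2 ≤ n → firstTrue G p n ≡ 1 → p 0 ≡ false × p 1 ≡ true
    firstTrue≡1⁻ p (s≤s (s≤s _)) = if-one⁻ (p 0) (p 1)

    firstTrue≡1⁺ : ∀ p {n} → 2 ≤ n → p 0 ≡ false → p 1 ≡ true → firstTrue G p n ≡ 1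
    firstTrue≡1⁺ p (s≤s (s≤s _)) p0 p1 rewrite p0 | p1 = refl

    through-self⁻ : ∀ {x} (g : V → Bool) xs → any (λ z → reach G 0 x z ∧ g z) xs ≡ true → g x ≡ true
    through-self⁻ {x} g (z ∷ zs) some with ∨-true⁻ {reach G 0 x z ∧ g z} some
    ... | inj₁ here′ = let (x≡z , gz) = ∧-true⁻ {reach G 0 x z} here′ in
                       subst (λ y → g y ≡ true) (sym (⌊⌋-true⁻ (x ≟V z) x≡z)) gz
    ... | inj₂ rest = through-self⁻ g zs rest

    through-self⁺ : ∀ {x} (g : V → Bool) xs → x ∈ xs → g x ≡ true → any (λ z → reach G 0 x z ∧ g z) xs ≡ true
    through-self⁺ {x} g (z ∷ zs) (here refl) gx =
      cong (_∨ any (λ z → reach G 0 x z ∧ g z) zs) (∧-true⁺ (⌊⌋-true⁺ (x ≟V x) refl) gx)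
    through-self⁺ {x} g (z ∷ zs) (there x∈zs) gx =
      trans (cong (reach G 0 x z ∧ g z ∨_) (through-self⁺ g zs x∈zs gx)) (∨-zeroʳ _)

  dist-refl : ∀ a → dist G a a ≡ 0
  dist-refl a = firstTrue≡0⁺ _ two-vertices (⌊⌋-true⁺ (a ≟V a) refl)

  dist≡0⇒≡ : ∀ {a c} → dist G a c ≡ 0 → a ≡ c
  dist≡0⇒≡ {a} {c} d≡0 = ⌊⌋-true⁻ (a ≟V c) (firstTrue≡0⁻ _ two-vertices d≡0)

  dist≡1⇒adj : ∀ {a c} → dist G a c ≡ 1 → adj a c ≡ true
  dist≡1⇒adj {a} {c} d≡1 =
    let (not-equal , one-step) = firstTrue≡1⁻ _ two-vertices d≡1 in
    through-self⁻ (λ z → adj z c) verts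
      (subst (λ s → s ∨ any (λ z → reach G 0 a z ∧ adj z c) verts ≡ true) not-equal one-step)

  adj⇒dist≡1 : ∀ {a c} → a ≢ c → adj a c ≡ true → dist G a c ≡ 1
  adj⇒dist≡1 {a} {c} a≢c ac = firstTrue≡1⁺ _ two-vertices not-equal
    (trans (cong (_∨ any (λ z → reach G 0 a z ∧ adj z c) verts) not-equal)
           (through-self⁺ (λ z → adj z c) verts (complete a) ac))
    where
    not-equal = ⌊⌋-false⁺ (a ≟V c) a≢c

  resolves-∈ : ∀ {cs z} → z ∈ cs → Resolves cs z
  resolves-∈ {z = z} z∈cs z′ same = sym (dist≡0⇒≡ (trans (sym (same z z∈cs)) (dist-refl z)))

module _ {v b r k lam : ℕ} (D : BIBD v b r k lam) where
  open BIBD D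

  length-incVerts : length (incVerts D) ≡ v + b
  length-incVerts = trans (length-++ (map inj₁ (allFin v)))
    (cong₂ _+_ (trans (length-map inj₁ (allFin v)) (length-tabulate {n = v} (λ i → i)))
               (trans (length-map inj₂ (allFin b)) (length-tabulate {n = b} (λ i → i))))

  walk-reaches-point-or-stays : ∀ {w} → IsWalk (IncidenceGraph D) w → ∀ {C} → w 0 ≡ inj₂ C → ∀ n →
    (∃ λ t → ∃ λ x → w t ≡ inj₁ x) ⊎ w n ≡ inj₂ C
  walk-reaches-point-or-stays walk w0 zero = inj₂ w0
  walk-reaches-point-or-stays {w} walk w0 (suc n) with walk-reaches-point-or-stays walk w0 n
  ... | inj₁ visited = inj₁ visited
  ... | inj₂ wn with w (suc n) in next | walk n
  ... | inj₁ x | _ = inj₁ (suc n , x , next)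
  ... | inj₂ _ | inj₁ stay = inj₂ (trans stay wn)
  ... | inj₂ C′ | inj₂ adjacent = ⊥-elim (true≢false (sym (subst (λ y → incAdj D y (inj₂ C′) ≡ true) wn adjacent)))

  Covers : Fin v → Fin v → Fin v → Set
  Covers u x y = ∀ B → inc u B ∧ inc x B ≡ true → inc y B ≡ true

  sameClass⇒covers : ∀ {u x y} → sameClass D u x y ≡ true → Covers u x y
  sameClass⇒covers same B = implication-true⁻ (allFinB-true⁻ _ same B)

  covers⇒sameClass : ∀ {u x y} → Covers u x y → sameClass D u x y ≡ true
  covers⇒sameClass x→y = allFinB-true⁺ _ (λ B → implication-true⁺ (x→y B))

  covers-refl : ∀ {u x} → Covers u x x
  covers-refl {u} B uxB = proj₂ (∧-true⁻ {inc u B} uxB)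

  covers-trans : ∀ {u x y z} → Covers u x y → Covers u y z → Covers u x z
  covers-trans {u} x→y y→z B uxB = y→z B (∧-true⁺ (proj₁ (∧-true⁻ {inc u B} uxB)) (x→y B uxB))

  -- Both {u,x} and {u,y} lie in exactly λ blocks, so an inclusion between these block sets is an equality.
  covers-sym : ∀ {u x y} → x ≢ u → y ≢ u → Covers u x y → Covers u y x
  covers-sym {u} {x} {y} x≢u y≢u x→y B uyB =
    proj₂ (∧-true⁻ {inc u B} (count-≡⇒⊇ _ _ ux⊆uy same-count B uyB))
    where
    ux⊆uy : ∀ B → inc u B ∧ inc x B ≡ true → inc u B ∧ inc y B ≡ true
    ux⊆uy B uxB = ∧-true⁺ (proj₁ (∧-true⁻ {inc u B} uxB)) (x→y B uxB)
    same-count = trans (balance u x (x≢u ∘ sym)) (sym (balance u y (y≢u ∘ sym)))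

  covers-u⇒λ≡r : ∀ {u y} → y ≢ u → Covers u u y → lam ≡ r
  covers-u⇒λ≡r {u} {y} y≢u u→y = begin
    lam               ≡⟨ sym (balance u y (y≢u ∘ sym)) ⟩
    countFin uy       ≡⟨ ≤-antisym (count-mono uy (inc u) (λ B → proj₁ ∘ ∧-true⁻)) (count-mono (inc u) uy u⊆uy) ⟩
    countFin (inc u)  ≡⟨ replication u ⟩
    r                 ∎
    where
    open ≡-Reasoning
    uy : Fin b → Bool
    uy B = inc u B ∧ inc y B
    u⊆uy : ∀ B → inc u B ≡ true → uy B ≡ true
    u⊆uy B uB = ∧-true⁺ uB (u→y B (∧-true⁺ uB uB))

  module Partition (u : Fin v) where

    nonRep : Fin v → Bool
    nonRep x = not (x ==F u) ∧ not (isRep D u x)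

    isRep⇒≢u : ∀ {x} → isRep D u x ≡ true → x ≢ u
    isRep⇒≢u {x} rep = ⌊⌋-false⁻ (x ≟F u) (not-true⁻ (proj₁ (∧-true⁻ rep)))

    nonRep-true⁻ : ∀ {x} → nonRep x ≡ true → x ≢ u × isRep D u x ≡ false
    nonRep-true⁻ {x} nr = let (x≢u , ¬rep) = ∧-true⁻ nr in
      ⌊⌋-false⁻ (x ≟F u) (not-true⁻ x≢u) , not-true⁻ ¬rep

    nonRep-false⁻ : ∀ {x} → nonRep x ≡ false → x ≡ u ⊎ isRep D u x ≡ true
    nonRep-false⁻ {x} ¬nr = Sum.map (⌊⌋-true⁻ (x ≟F u) ∘ not-false⁻) not-false⁻ (∧-false⁻ ¬nr)

    smaller⇒¬isRep : ∀ {x y} → y ≢ u → toℕ y < toℕ x → Covers u x y → isRep D u x ≡ false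
    smaller⇒¬isRep {x} {y} y≢u y<x x→y =
      trans (cong (λ s → not (x ==F u) ∧ not s) witnessed) (∧-zeroʳ _)
      where
      witnessed : anyFinB (λ y → (toℕ y <ᵇ toℕ x) ∧ inClassOf D u x y) ≡ true
      witnessed = anyFinB-true⁺ _ y
        (∧-true⁺ (<ᵇ-true⁺ y<x) (∧-true⁺ (cong not (⌊⌋-false⁺ (y ≟F u) y≢u)) (covers⇒sameClass x→y)))

    ¬isRep⇒smaller : ∀ {x} → x ≢ u → isRep D u x ≡ false → Σ (Fin v) λ y → toℕ y < toℕ x × y ≢ u × Covers u x y
    ¬isRep⇒smaller {x} x≢u ¬rep =
      let smaller = λ y → (toℕ y <ᵇ toℕ x) ∧ inClassOf D u x y
          (y , found) = anyFinB-true⁻ smaller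
            (not-false⁻ (subst (λ s → not s ∧ not (anyFinB smaller) ≡ false) (⌊⌋-false⁺ (x ≟F u) x≢u) ¬rep))
          (y<x , in-class) = ∧-true⁻ found
          (y≢u , same) = ∧-true⁻ in-class
      in y , <ᵇ-true⁻ y<x , ⌊⌋-false⁻ (y ≟F u) (not-true⁻ y≢u) , sameClass⇒covers same

    representative : ∀ {x} → x ≢ u → Σ (Fin v) λ ρ → isRep D u ρ ≡ true × Covers u ρ x
    representative {x} = descend x (<-wellFounded x)
      where
      descend : ∀ x → Acc Fin._<_ x → x ≢ u → Σ (Fin v) λ ρ → isRep D u ρ ≡ true × Covers u ρ x
      descend x (acc smaller) x≢u with isRep D u x in rep
      ... | true = x , rep , covers-refl
      ... | false =
        let (y , y<x , y≢u , x→y) = ¬isRep⇒smaller x≢u rep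
            (ρ , ρ-rep , ρ→y) = descend y (smaller y<x) y≢u
        in ρ , ρ-rep , covers-trans ρ→y (covers-sym x≢u y≢u x→y)

    -- Each non-representative x is charged to the representative of its part (counted there among
    -- the |X_i| - 1 members other than the representative).
    count-nonRep≤f : countFin nonRep ≤ f D u
    count-nonRep≤f = ≤-trans (count≤sum-count nonRep charged charge) (sumFin-mono part-bound)
      where
      charged : Fin v → Fin v → Bool
      charged ρ x = isRep D u ρ ∧ (inClassOf D u ρ x ∧ not (x ==F ρ))

      charge : ∀ x → nonRep x ≡ true → Σ (Fin v) λ ρ → charged ρ x ≡ true
      charge x nr =
        let (x≢u , ¬rep) = nonRep-true⁻ nr
            (ρ , ρ-rep , ρ→x) = representative x≢u
            x≢ρ : x ≢ ρ
            x≢ρ x≡ρ = true≢false (trans (sym ρ-rep) (trans (cong (isRep D u) (sym x≡ρ)) ¬rep))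
        in ρ , ∧-true⁺ ρ-rep (∧-true⁺ (∧-true⁺ (proj₁ (∧-true⁻ nr)) (covers⇒sameClass ρ→x))
                                     (cong not (⌊⌋-false⁺ (x ≟F ρ) x≢ρ)))

      part-bound : ∀ ρ → countFin (λ x → isRep D u ρ ∧ (inClassOf D u ρ x ∧ not (x ==F ρ)))
                          ≤ (if isRep D u ρ then classSize D u ρ ∸ 1 else 0)
      part-bound ρ with isRep D u ρ in ρ-rep
      ... | false = ≤-reflexive (sumFin-zero {v} (λ _ → refl))
      ... | true = <⇒≤∸1 (count-< _ (inClassOf D u ρ) (λ _ → proj₁ ∘ ∧-true⁻) ρ ρ-in-class ρ-excluded)
        where
        ρ-in-class : inClassOf D u ρ ρ ≡ true
        ρ-in-class = ∧-true⁺ (proj₁ (∧-true⁻ ρ-rep)) (covers⇒sameClass covers-refl)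
        ρ-excluded : inClassOf D u ρ ρ ∧ not (ρ ==F ρ) ≡ false
        ρ-excluded = trans (cong (λ s → inClassOf D u ρ ρ ∧ not s) (⌊⌋-true⁺ (ρ ≟F ρ) refl)) (∧-zeroʳ _)

  module Game (1≤λ : 1 ≤ lam) (λ<r : lam < r) (u : Fin v) where
    open Partition u
    open Probing (IncidenceGraph D)

    pair-in-block : ∀ x → Σ (Fin b) λ B → inc u B ∧ inc x B ≡ true
    pair-in-block x with x ≟F u
    ... | yes refl =
      let (B , uB) = count-witness (inc u) (subst (1 ≤_) (sym (replication u)) (≤-trans 1≤λ (<⇒≤ λ<r)))
      in B , ∧-true⁺ uB uB
    ... | no x≢u = count-witness (λ B → inc u B ∧ inc x B) (subst (1 ≤_) (sym (balance u x (x≢u ∘ sym))) 1≤λ)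

    two-vertices : 2 ≤ length (incVerts D)
    two-vertices = subst (2 ≤_) (sym length-incVerts)
      (+-mono-≤ (nonempty u) (nonempty (proj₁ (pair-in-block u))))
      where
      nonempty : ∀ {n} → Fin n → 1 ≤ n
      nonempty i = ≤-trans (s≤s z≤n) (toℕ<n i)

    open Distance (IncidenceGraph D) two-vertices

    incident-from-distances : ∀ {cs x z′ B} → SameDistances cs (inj₁ x) z′ → inj₂ B ∈ cs →
      inc x B ≡ true → incAdj D (inj₂ B) z′ ≡ true
    incident-from-distances same B∈cs xB = dist≡1⇒adj (trans (sym (same _ B∈cs)) (adj⇒dist≡1 (λ ()) xB))

    covers-antisym : ∀ {x x′} → nonRep x ≡ false → nonRep x′ ≡ false →
      Covers u x x′ → Covers u x′ x → x ≡ x′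
    covers-antisym {x} {x′} ¬nr ¬nr′ x→x′ x′→x with nonRep-false⁻ {x} ¬nr | nonRep-false⁻ {x′} ¬nr′
    ... | inj₁ refl | inj₁ refl = refl
    ... | inj₁ refl | inj₂ rep′ = ⊥-elim (<-irrefl (covers-u⇒λ≡r (isRep⇒≢u rep′) x→x′) λ<r)
    ... | inj₂ rep  | inj₁ refl = ⊥-elim (<-irrefl (covers-u⇒λ≡r (isRep⇒≢u rep) x′→x) λ<r)
    ... | inj₂ rep  | inj₂ rep′ with <-cmp (toℕ x) (toℕ x′)
    ... | tri< x<x′ _ _ = ⊥-elim (true≢false (trans (sym rep′) (smaller⇒¬isRep (isRep⇒≢u rep) x<x′ x′→x)))
    ... | tri≈ _ x≡x′ _ = toℕ-injective x≡x′
    ... | tri> _ _ x′<x = ⊥-elim (true≢false (trans (sym rep) (smaller⇒¬isRep (isRep⇒≢u rep′) x′<x x→x′)))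

    resolves-point : ∀ {cs} → (∀ B → inc u B ≡ true → inj₂ B ∈ cs) → (∀ y → nonRep y ≡ true → inj₁ y ∈ cs) →
      ∀ x → Resolves cs (inj₁ x)
    resolves-point blocks⊆ _ x (inj₂ C) same =
      let (B , uxB) = pair-in-block x
          (uB , xB) = ∧-true⁻ {inc u B} uxB
      in ⊥-elim (true≢false (sym (incident-from-distances same (blocks⊆ B uB) xB)))
    resolves-point blocks⊆ nonReps⊆ x (inj₁ x′) same with nonRep x in nr | nonRep x′ in nr′
    ... | true  | _    = resolves-∈ (nonReps⊆ x nr) (inj₁ x′) same
    ... | false | true = sym (resolves-∈ (nonReps⊆ x′ nr′) (inj₁ x) (same-distances-sym same))
    ... | false | false = cong inj₁ (sym (covers-antisym nr nr′ (covers same) (covers (same-distances-sym same))))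
      where
      covers : ∀ {y y′} → SameDistances _ (inj₁ y) (inj₁ y′) → Covers u y y′
      covers same B uyB = incident-from-distances same (blocks⊆ B (proj₁ (∧-true⁻ uyB))) (proj₂ (∧-true⁻ {inc u B} uyB))

    spare : ℕ → Fin v ⊎ Fin b
    spare t with t <? b
    ... | yes t<b = inj₂ (fromℕ< t<b)
    ... | no _ = inj₁ u

    spare-toℕ : ∀ C → spare (toℕ C) ≡ inj₂ C
    spare-toℕ C with toℕ C <? b
    ... | yes C<b = cong inj₂ (fromℕ<-toℕ C C<b)
    ... | no C≮b = ⊥-elim (C≮b (toℕ<n C))

    probes : ℕ → List (Fin v ⊎ Fin b)
    probes t = spare t ∷ map inj₂ (filterFin (inc u)) ++ map inj₁ (filterFin nonRep)

    length-probes : ∀ t → length (probes t) ≤ f D u + r + 1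
    length-probes t = begin
      length (probes t)
        ≡⟨ cong suc (length-++ (map inj₂ (filterFin (inc u)))) ⟩
      suc (length (map inj₂ (filterFin (inc u))) + length (map inj₁ (filterFin nonRep)))
        ≡⟨ cong suc (cong₂ _+_ (trans (length-map inj₂ (filterFin (inc u))) (trans (length-filterFin (inc u)) (replication u)))
                               (trans (length-map inj₁ (filterFin nonRep)) (length-filterFin nonRep))) ⟩
      suc (r + countFin nonRep)
        ≤⟨ s≤s (+-monoʳ-≤ r count-nonRep≤f) ⟩
      suc (r + f D u)
        ≡⟨ trans (cong suc (+-comm r (f D u))) (+-comm 1 (f D u + r)) ⟩
      f D u + r + 1 ∎
      where open ≤-Reasoning

    cops-win : CopsWin (IncidenceGraph D) (f D u + r + 1)
    cops-win = probing (inj₁ u) probes , capture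
      where
      captured : ∀ w t → Resolves (probes t) (w t) → CapturedAt (IncidenceGraph D) (probing (inj₁ u) probes) w t
      captured w t = probing-captures (inj₁ u) probes w t (length-probes t)

      on-point : ∀ w t x → w t ≡ inj₁ x → CapturedAt (IncidenceGraph D) (probing (inj₁ u) probes) w t
      on-point w t x wt≡x = captured w t (subst (Resolves (probes t)) (sym wt≡x) (resolves-point
        (λ B uB → there (∈-++⁺ˡ (∈-map⁺ inj₂ (∈-filterFin⁺ (inc u) uB))))
        (λ y nr → there (∈-++⁺ʳ (map inj₂ (filterFin (inc u))) (∈-map⁺ inj₁ (∈-filterFin⁺ nonRep nr))))
        x))

      capture : ∀ w → IsWalk (IncidenceGraph D) w → ∃ λ t → CapturedAt (IncidenceGraph D) (probing (inj₁ u) probes) w t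
      capture w walk with w 0 in w0
      ... | inj₁ x = 0 , on-point w 0 x w0
      ... | inj₂ C with walk-reaches-point-or-stays walk w0 (toℕ C)
      ... | inj₁ (t , x , wt≡x) = t , on-point w t x wt≡x
      ... | inj₂ wt≡C = toℕ C , captured w (toℕ C)
              (subst (Resolves (probes (toℕ C))) (sym wt≡C) (resolves-∈ (here (sym (spare-toℕ C)))))

theorem2p3 : ∀ {v b r k lam : ℕ} (D : BIBD v b r k lam) →
    1 ≤ v → 2 ≤ lam → lam ≤ r ∸ 1 →
    ZetaAtMost (IncidenceGraph D) (fG D + r + 1)
theorem2p3 {suc v} {r = r} D (s≤s z≤n) 2≤λ λ≤r∸1 =
  let (u , fG≡fu) = minFin-attained (f D) in
  f D u + r + 1 , ≤-reflexive (cong (λ n → n + r + 1) (sym fG≡fu)) ,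
  Game.cops-win D 1≤λ (≤∸1⇒< 1≤λ λ≤r∸1) u
  where
  1≤λ = ≤-trans (s≤s z≤n) 2≤λ
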